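{- For a finite set $X$ and an integer $t\ge 1$, the number of equivalence classes of partial decompositions with vertex set $X$ that are restrictions (to $X$) of some rooted tree and have height at most $t$ is at most $2^{|X| t + |X| \log t + |X| \log |X|}$ (logarithms to base $2$).
   Context: A rooted forest is a disjoint union of rooted trees; a leaf is a node without children. For a node $x$, an ancestor of $x$ is any node other than $x$ on the path from the root of its tree to $x$. Depth of a node: number of vertices on the path from its root to it (roots have depth $1$); height of a forest: maximum depth; the height of a node $x$ in a tree $T$ is the height of the subtree $T_x$ consisting of $x$ and its descendants. A partial decomposition is a triple $(F,X,h)$ with $F$ a rooted forest, $X\subseteq V(F)$, and $h\colon V(F)\to\mathbb{N}^+$ with $h(x)>h(y)$ whenever $x$ is an ancestor of $y$; its height is $\max h(x)$ over roots $x$ of $F$. Its restriction to $X'\subseteq X$ is $(F',X',h|_{V(F')})$ where $F'$ is obtained from $F$ by iteratively deleting leaves not in $X'$. Two partial decompositions $(F_1,X_1,h_1),(F_2,X_2,h_2)$ are equivalent if $X_1=X_2$ and there is an isomorphism $\psi\colon F_1\to F_2$ of rooted forests that is the identity on $X_1$ and satisfies $h_1(v)=h_2(\psi(v))$ for all $v\in V(F_1)$. Given a rooted tree $T$ with $X\subseteq V(T)$, let $h_T(x)$ be the height of $x$ in $T$; a partial decomposition $(F',X,h')$ is a restriction of $T$ to $X$ if it is equivalent to the restriction of $(T,V(T),h_T)$ to $X$. -}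

module Defs where

open import Data.Nat using (ℕ; zero; suc; _≤_; _<_; _+_; _*_; _^_)
open import Data.Fin using (Fin)
open import Data.Maybe using (Maybe; just; nothing; _>>=_)
open import Data.Maybe as M using ()
open import Data.Product using (Σ; ∃; ∃-syntax; _×_; _,_)
open import Function.Bundles using (_↔_; Inverse)
open import Function.Definitions using (Injective)
open import Relation.Binary.PropositionalEquality using (_≡_)

iterParent : ∀ {m} → (Fin m → Maybe (Fin m)) → ℕ → Fin m → Maybe (Fin m)
iterParent p zero    v = just v
iterParent p (suc k) v = iterParent p k v >>= p

record Forest : Set where
  field
    size    : ℕ
    parent  : Fin size → Maybe (Fin size)
    acyclic : ∀ v → ∃[ k ] (iterParent parent k v ≡ nothing)

open Forest public

IsRoot : (F : Forest) → Fin (size F) → Set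
IsRoot F v = parent F v ≡ nothing

Ancestor : (F : Forest) → Fin (size F) → Fin (size F) → Set
Ancestor F x y = ∃[ k ] (iterParent (parent F) (suc k) y ≡ just x)

IsTree : Forest → Set
IsTree F = ∃[ r ] (IsRoot F r × (∀ v → IsRoot F v → v ≡ r))

-- HeightIs F x h : the height of x in F (height of the subtree F_x,
-- counting vertices, so leaves have height 1) equals h.
HeightIs : (F : Forest) → Fin (size F) → ℕ → Set
HeightIs F x h =
  ∃[ k ] ( (h ≡ suc k)
         × (∃[ y ] (iterParent (parent F) k y ≡ just x))
         × (∀ k' y → iterParent (parent F) k' y ≡ just x → k' ≤ k))

record PartialDecomposition (n : ℕ) : Set where
  field
    forest   : Forest
    emb      : Fin n → Fin (size forest)
    emb-inj  : Injective _≡_ _≡_ emb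
    hgt      : Fin (size forest) → ℕ
    hgt-pos  : ∀ v → 1 ≤ hgt v
    hgt-anc  : ∀ x y → Ancestor forest x y → hgt y < hgt x

open PartialDecomposition public

HeightAtMost : ∀ {n} → PartialDecomposition n → ℕ → Set
HeightAtMost D t = ∀ r → IsRoot (forest D) r → hgt D r ≤ t

Equivalent : ∀ {n} → PartialDecomposition n → PartialDecomposition n → Set
Equivalent D₁ D₂ =
  Σ (Fin (size (forest D₁)) ↔ Fin (size (forest D₂))) λ ψ →
    let f = Inverse.to ψ in
      (∀ v → parent (forest D₂) (f v) ≡ M.map f (parent (forest D₁) v))
    × (∀ i → f (emb D₁ i) ≡ emb D₂ i)
    × (∀ v → hgt D₁ v ≡ hgt D₂ (f v))

-- The restriction keeps exactly the vertices of T that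
-- are in X or have a descendant in X (the result of iteratively deleting
-- leaves not in X), with the induced parent relation and heights h_T.
IsRestrictionVia : ∀ {n} → PartialDecomposition n → (T : Forest) →
                   (Fin n → Fin (size T)) → Set
IsRestrictionVia D T ι =
  Σ (Fin (size (forest D)) → Fin (size T)) λ φ →
      Injective _≡_ _≡_ φ
    × (∀ v → parent T (φ v) ≡ M.map φ (parent (forest D) v))
    × (∀ i → φ (emb D i) ≡ ι i)
    × (∀ w → (∃[ v ] (φ v ≡ w)) → ∃[ i ] ∃[ k ] (iterParent (parent T) k (ι i) ≡ just w))
    × (∀ w → (∃[ i ] ∃[ k ] (iterParent (parent T) k (ι i) ≡ just w)) → ∃[ v ] (φ v ≡ w))
    × (∀ v → HeightIs T (φ v) (hgt D v))

IsRestrictionOfTree : ∀ {n} → PartialDecomposition n → Set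
IsRestrictionOfTree {n} D =
  Σ Forest λ T → IsTree T ×
    Σ (Fin n → Fin (size T)) λ ι → Injective _≡_ _≡_ ι × IsRestrictionVia D T ι

-- 2^(n t + n log t + n log n) = 2^(n t) * t^n * n^n
bound : ℕ → ℕ → ℕ
bound n t = 2 ^ (n * t) * t ^ n * n ^ n

-- A node of a restriction lies on the path from some leaf i ∈ X to the root, and heights strictly
-- increase along such a path; so a node is named by a leaf below it and its height, and the
-- decomposition is determined up to equivalence by the relation "the paths of i and j share their
-- node of height s".  This relation is recovered from t bits per leaf (which heights occur on its
-- path) and, per leaf i, a pointer j to an earlier leaf whose path meets that of i lowest, together
-- with that height m (t^n n^n choices; j = i if there is no such leaf): above height m the paths of
-- i and j coincide, so the meets of i with earlier leaves are those of j, by induction on i.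

module Submission where

open import Defs
open import Data.Bool using (Bool; T)
open import Data.Empty using (⊥-elim)
open import Data.Fin as Fin using (Fin; toℕ; fromℕ<; combine; remQuot; funToFin; finToFun)
open import Data.Fin.Properties
  using (toℕ-fromℕ<; toℕ-injective; toℕ<n; toℕ-inject; remQuot-combine; combine-injective;
         finToFun-funToFin; ¬∀⟶∃¬-smallest; any?; all?; 2↔Bool)
  renaming (_≟_ to _≟ᶠ_)
open import Data.Maybe using (Maybe; just; nothing; _>>=_)
import Data.Maybe as M
open import Data.Maybe.Properties using (just-injective; map-injective; ≡-dec)
open import Data.Nat using (ℕ; zero; suc; _≤_; _<_; _+_; _*_; _^_; _∸_; z≤n; s≤s; NonZero; >-nonZero⁻¹)
open import Data.Nat.Properties
open import Data.Product using (Σ; ∃-syntax; _×_; _,_; proj₁; proj₂; uncurry)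
open import Data.Sum using (_⊎_; inj₁; inj₂)
open import Function using (_∘_)
open import Function.Bundles using (_↣_; Injection; mk↔ₛ′)
open import Function.Properties.Inverse using (↔-sym; ↔⇒↣)
open import Level using (0ℓ)
open import Relation.Binary.Definitions using (tri<; tri≈; tri>)
open import Relation.Binary.PropositionalEquality
open import Relation.Nullary using (Dec; yes; no; ¬_; ¬?)
open import Relation.Nullary.Decidable using (isYes; toWitness; fromWitness; map′; _×-dec_; decidable-stable)
open import Relation.Unary using (Pred; Decidable)

least? : ∀ {m} {P : Pred (Fin m) 0ℓ} → Decidable P →
         (∃[ x ] P x × (∀ y → P y → x Fin.≤ y)) ⊎ (∀ y → ¬ P y)
least? {m} {P} P? with all? (¬? ∘ P?)
... | yes none = inj₂ none
... | no some with ¬∀⟶∃¬-smallest m (¬_ ∘ P) (¬? ∘ P?) some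
...   | x , ¬¬Px , below = inj₁ (x , decidable-stable (P? x) ¬¬Px , least)
  where
    least : ∀ y → P y → x Fin.≤ y
    least y Py = ≮⇒≥ λ y<x → below (fromℕ< y<x)
      (subst P (sym (toℕ-injective (trans (toℕ-inject (fromℕ< y<x)) (toℕ-fromℕ< y<x)))) Py)

funToFin-injective : ∀ {m k} {f g : Fin m → Fin k} → funToFin f ≡ funToFin g → ∀ x → f x ≡ g x
funToFin-injective {f = f} {g} eq x = begin
  f x                       ≡⟨ finToFun-funToFin f x ⟨
  finToFun (funToFin f) x   ≡⟨ cong (λ c → finToFun c x) eq ⟩
  finToFun (funToFin g) x   ≡⟨ finToFun-funToFin g x ⟩
  g x                       ∎
  where open ≡-Reasoning

bool↣fin2 : Bool ↣ Fin 2
bool↣fin2 = ↔⇒↣ (↔-sym 2↔Bool)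

record Code (n t : ℕ) : Set where
  field
    hits        : Fin n → Fin t → Bool
    merge       : Fin n → Fin n
    mergeHeight : Fin n → Fin t

open Code

record _≋_ {n t : ℕ} (c c' : Code n t) : Set where
  field
    same-hits        : ∀ i f → hits c i f ≡ hits c' i f
    same-merge       : ∀ i → merge c i ≡ merge c' i
    same-mergeHeight : ∀ i → mergeHeight c i ≡ mergeHeight c' i

open _≋_

≋-sym : ∀ {n t} {c c' : Code n t} → c ≋ c' → c' ≋ c
≋-sym same = record
  { same-hits        = λ i f → sym (same-hits same i f)
  ; same-merge       = λ i → sym (same-merge same i)
  ; same-mergeHeight = λ i → sym (same-mergeHeight same i)
  }

-- The n t hit bits are read as one function on Fin (n * t), giving the factor 2 ^ (n * t).
encode : ∀ {n t} → Code n t → Fin (bound n t)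
encode {n} {t} c = combine (combine (funToFin bits) (funToFin (mergeHeight c))) (funToFin (merge c))
  where
    bits : Fin (n * t) → Fin 2
    bits = Injection.to bool↣fin2 ∘ uncurry (hits c) ∘ remQuot t

encode-injective : ∀ {n t} (c c' : Code n t) → encode c ≡ encode c' → c ≋ c'
encode-injective {n} {t} c c' eq = record
  { same-hits        = hits-agree
  ; same-merge       = funToFin-injective (proj₂ outer)
  ; same-mergeHeight = funToFin-injective (proj₂ inner)
  }
  where
    outer = combine-injective {2 ^ (n * t) * t ^ n} {n ^ n} _ _ _ _ eq
    inner = combine-injective {2 ^ (n * t)} {t ^ n} _ _ _ _ (proj₁ outer)
    hits-at : ∀ (c : Code n t) i f → uncurry (hits c) (remQuot t (combine i f)) ≡ hits c i f
    hits-at c i f = cong (uncurry (hits c)) (remQuot-combine i f)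
    hits-agree : ∀ i f → hits c i f ≡ hits c' i f
    hits-agree i f = begin
      hits c i f                                    ≡⟨ hits-at c i f ⟨
      uncurry (hits c) (remQuot t (combine i f))
        ≡⟨ Injection.injective bool↣fin2 (funToFin-injective (proj₁ inner) (combine i f)) ⟩
      uncurry (hits c') (remQuot t (combine i f))   ≡⟨ hits-at c' i f ⟩
      hits c' i f                                   ∎
      where open ≡-Reasoning

module _ {m : ℕ} (p : Fin m → Maybe (Fin m)) where

  iterParent-+ : ∀ d k v {w} → iterParent p k v ≡ just w → iterParent p (d + k) v ≡ iterParent p d w
  iterParent-+ zero    k v e = e
  iterParent-+ (suc d) k v e = cong (_>>= p) (iterParent-+ d k v e)

  iterParent-nothing-+ : ∀ d k v → iterParent p k v ≡ nothing → iterParent p (d + k) v ≡ nothing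
  iterParent-nothing-+ zero    k v e = e
  iterParent-nothing-+ (suc d) k v e = cong (_>>= p) (iterParent-nothing-+ d k v e)

  iterParent-suc-just : ∀ k v {u} → iterParent p (suc k) v ≡ just u →
                        ∃[ x ] iterParent p k v ≡ just x × p x ≡ just u
  iterParent-suc-just k v e with iterParent p k v
  ... | just x = x , refl , e

  reaches-root : ∀ k v → iterParent p k v ≡ nothing →
               ∃[ r ] (∃[ d ] iterParent p d v ≡ just r) × p r ≡ nothing
  reaches-root (suc k) v e with iterParent p k v in eq
  ... | nothing = reaches-root k v eq
  ... | just r  = r , (k , eq) , e

iterParent-map : ∀ {a b} {p : Fin a → Maybe (Fin a)} {q : Fin b → Maybe (Fin b)} (φ : Fin a → Fin b) →
                 (∀ v → q (φ v) ≡ M.map φ (p v)) →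
                 ∀ k v → iterParent q k (φ v) ≡ M.map φ (iterParent p k v)
iterParent-map φ hom zero    v = refl
iterParent-map {p = p} {q} φ hom (suc k) v with iterParent p k v | iterParent-map {p = p} {q} φ hom k v
... | nothing | e = cong (_>>= q) e
... | just y  | e = trans (cong (_>>= q) e) (hom y)

module Paths {n : ℕ} (D : PartialDecomposition n) where

  private
    V : Set
    V = Fin (size (forest D))
    p : V → Maybe V
    p = parent (forest D)
    h : V → ℕ
    h = hgt D

  iterParent-hgt : ∀ k v {u} → iterParent p k v ≡ just u → k + h v ≤ h u
  iterParent-hgt zero    v refl = ≤-refl
  iterParent-hgt (suc k) v e with iterParent-suc-just p k v e
  ... | x , ex , px = <-≤-trans (s≤s (iterParent-hgt k v ex)) (hgt-anc D _ x (0 , px))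

  heightAtMost⇒hgt≤ : ∀ {t} → HeightAtMost D t → ∀ v → h v ≤ t
  heightAtMost⇒hgt≤ bounded v with acyclic (forest D) v
  ... | k , e with reaches-root p k v e
  ... | r , (d , er) , root = ≤-trans (m+n≤o⇒n≤o d (iterParent-hgt d v er)) (bounded r root)

  path : Fin n → ℕ → Maybe V
  path i k = iterParent p k (emb D i)

  _∈Path_ : V → Fin n → Set
  u ∈Path i = ∃[ k ] path i k ≡ just u

  path-offset : ∀ {i k k' x} → path i k ≡ just x → k ≤ k' → path i k' ≡ iterParent p (k' ∸ k) x
  path-offset {i} {k} {k'} {x} e k≤k' = begin
    path i k'                ≡⟨ cong (path i) (m∸n+n≡m k≤k') ⟨
    path i (k' ∸ k + k)      ≡⟨ iterParent-+ p (k' ∸ k) k (emb D i) e ⟩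
    iterParent p (k' ∸ k) x  ∎
    where open ≡-Reasoning

  path-hgt-≤ : ∀ {i k k' x y} → path i k ≡ just x → path i k' ≡ just y → k ≤ k' → h x ≤ h y
  path-hgt-≤ {k = k} {k'} {x} ex ey k≤k' =
    m+n≤o⇒n≤o (k' ∸ k) (iterParent-hgt (k' ∸ k) x (trans (sym (path-offset ex k≤k')) ey))

  path-hgt-< : ∀ {i k k' x y} → path i k ≡ just x → path i k' ≡ just y → k < k' → h x < h y
  path-hgt-< {k = k} {k'} {x} ex ey k<k' =
    ≤-trans (+-monoˡ-≤ (h x) (m<n⇒0<n∸m k<k'))
            (iterParent-hgt (k' ∸ k) x (trans (sym (path-offset ex (<⇒≤ k<k'))) ey))

  path-index-≤ : ∀ {i k k' x y} → path i k ≡ just x → path i k' ≡ just y → h x ≤ h y → k ≤ k'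
  path-index-≤ ex ey hx≤hy = ≮⇒≥ λ k'<k → <⇒≱ (path-hgt-< ey ex k'<k) hx≤hy

  path-index-< : ∀ {i k k' x y} → path i k ≡ just x → path i k' ≡ just y → h x < h y → k < k'
  path-index-< ex ey hx<hy = ≰⇒> λ k'≤k → <⇒≱ hx<hy (path-hgt-≤ ey ex k'≤k)

  path-index<hgt : ∀ {i k u} → path i k ≡ just u → k < h u
  path-index<hgt {i} {k} e = <-≤-trans (m<m+n k (hgt-pos D (emb D i))) (iterParent-hgt k (emb D i) e)

  ∈Path-hgt-injective : ∀ {i u w} → u ∈Path i → w ∈Path i → h u ≡ h w → u ≡ w
  ∈Path-hgt-injective (k , eu) (k' , ew) hu≡hw with <-cmp k k'
  ... | tri< k<k' _ _ = ⊥-elim (<-irrefl hu≡hw (path-hgt-< eu ew k<k'))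
  ... | tri≈ _ refl _ = just-injective (trans (sym eu) ew)
  ... | tri> _ _ k>k' = ⊥-elim (<-irrefl (sym hu≡hw) (path-hgt-< ew eu k>k'))

  emb-lowest : ∀ {i u} → u ∈Path i → h (emb D i) ≤ h u
  emb-lowest {i} (k , e) = path-hgt-≤ {i} {0} {k} refl e z≤n

  ∈Path-upward : ∀ {i j u w} → w ∈Path i → u ∈Path i → h w ≤ h u → w ∈Path j → u ∈Path j
  ∈Path-upward {i} {j} {u} {w} (kw , ew) (ku , eu) hw≤hu (l , el) = ku ∸ kw + l , (begin
    path j (ku ∸ kw + l)      ≡⟨ iterParent-+ p (ku ∸ kw) l (emb D j) el ⟩
    iterParent p (ku ∸ kw) w  ≡⟨ path-offset {i} {kw} {ku} ew (path-index-≤ {i} {kw} {ku} ew eu hw≤hu) ⟨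
    path i ku                 ≡⟨ eu ⟩
    just u                    ∎)
    where open ≡-Reasoning

  parent-∈Path : ∀ {i v u} → v ∈Path i → p v ≡ just u →
                 u ∈Path i × h v < h u × (∀ {x} → x ∈Path i → h v < h x → h u ≤ h x)
  parent-∈Path {i} {v} {u} (k , ev) pv = (suc k , eu) , path-hgt-< {i} {k} {suc k} ev eu ≤-refl , lowest
    where
      eu : path i (suc k) ≡ just u
      eu = trans (cong (_>>= p) ev) pv
      lowest : ∀ {x} → x ∈Path i → h v < h x → h u ≤ h x
      lowest (kx , ex) hv<hx = path-hgt-≤ {i} {suc k} {kx} eu ex (path-index-< {i} {k} {kx} ev ex hv<hx)

  root-∈Path : ∀ {i v} → v ∈Path i → p v ≡ nothing → ∀ {x} → x ∈Path i → h x ≤ h v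
  root-∈Path {i} (k , ev) pv (kx , ex) = path-hgt-≤ {i} {kx} {k} ex ev (≤-pred (≰⇒> beyond))
    where
      ended : path i (suc k) ≡ nothing
      ended = trans (cong (_>>= p) ev) pv
      beyond : ¬ suc k ≤ kx
      beyond sk≤kx with trans (sym ex) (trans (cong (path i) (sym (m∸n+n≡m sk≤kx)))
                                             (iterParent-nothing-+ p (kx ∸ suc k) (suc k) (emb D i) ended))
      ... | ()

  _∈Path?_ : ∀ u i → Dec (u ∈Path i)
  u ∈Path? i = map′ (λ (k , _ , e) → k , e) (λ (k , e) → k , path-index<hgt e , e)
                    (anyUpTo? (λ k → ≡-dec _≟ᶠ_ (path i k) (just u)) (h u))

  MeetAt : Fin n → Fin n → ℕ → Set
  MeetAt i j s = ∃[ u ] u ∈Path i × u ∈Path j × h u ≡ s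

  meetAt? : ∀ i j s → Dec (MeetAt i j s)
  meetAt? i j s = any? λ u → (u ∈Path? i) ×-dec (u ∈Path? j) ×-dec (h u ≟ s)

  meetAt-sym : ∀ {i j s} → MeetAt i j s → MeetAt j i s
  meetAt-sym (u , ui , uj , hu) = u , uj , ui , hu

  meetAt-above : ∀ {i j k m s} → MeetAt i j m → m ≤ s → MeetAt i k s → MeetAt j k s
  meetAt-above (w , wi , wj , refl) m≤s (u , ui , uk , refl) = u , ∈Path-upward wi ui m≤s wj , uk , refl

  EarliestMeet : Fin n → Fin n → ℕ → Set
  EarliestMeet i j m = j Fin.< i × MeetAt i j m × (∀ k s → k Fin.< i → MeetAt i k s → m ≤ s)

  -- j = i encodes that the path of i meets no earlier path; m is then arbitrary.
  MergeRecord : Fin n → Fin n → ℕ → Set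
  MergeRecord i j m = EarliestMeet i j m ⊎ (j ≡ i × (∀ k s → k Fin.< i → ¬ MeetAt i k s))

  mergeRecord-below : ∀ {i j k m s} → MergeRecord i j m → k Fin.< i → MeetAt i k s →
                      j Fin.< i × m ≤ s × MeetAt j k s
  mergeRecord-below (inj₁ (j<i , meet-ij , earliest)) k<i meet-ik =
    j<i , m≤s , meetAt-above meet-ij m≤s meet-ik
    where m≤s = earliest _ _ k<i meet-ik
  mergeRecord-below (inj₂ (_ , none)) k<i meet-ik = ⊥-elim (none _ _ k<i meet-ik)

  mergeRecord-above : ∀ {i j k m s} → MergeRecord i j m → j Fin.< i → m ≤ s → MeetAt j k s → MeetAt i k s
  mergeRecord-above (inj₁ (_ , meet-ij , _)) j<i m≤s meet-jk = meetAt-above (meetAt-sym meet-ij) m≤s meet-jk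
  mergeRecord-above (inj₂ (refl , _))        j<i = ⊥-elim (<-irrefl refl j<i)

Covered : ∀ {n} → PartialDecomposition n → Set
Covered D = ∀ v → ∃[ i ] v ∈Path i
  where open Paths D

MeetAt⇒ : ∀ {n} → PartialDecomposition n → PartialDecomposition n → Set
MeetAt⇒ D D' = ∀ {i j s} → Paths.MeetAt D i j s → Paths.MeetAt D' i j s

module Coding {n : ℕ} (D : PartialDecomposition n) (t : ℕ) .{{_ : NonZero t}} (bounded : HeightAtMost D t) where

  open Paths D

  hgtCode : ∀ v → Σ (Fin t) λ f → suc (toℕ f) ≡ hgt D v
  hgtCode v with hgt D v | hgt-pos D v | heightAtMost⇒hgt≤ bounded v
  ... | suc k | _ | k<t = fromℕ< k<t , cong suc (toℕ-fromℕ< k<t)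

  meetAt-code : ∀ {i k s} → MeetAt i k s → Σ (Fin t) λ f → suc (toℕ f) ≡ s
  meetAt-code (u , _ , _ , hu) = proj₁ (hgtCode u) , trans (proj₂ (hgtCode u)) hu

  mergeRecord : ∀ i → Σ (Fin n × Fin t) λ (j , f) → MergeRecord i j (suc (toℕ f))
  mergeRecord i with least? (λ f → any? λ k → (k Fin.<? i) ×-dec meetAt? i k (suc (toℕ f)))
  ... | inj₁ (f , (j , j<i , meet) , least) = (j , f) , inj₁ (j<i , meet , earliest)
    where
      earliest : ∀ k s → k Fin.< i → MeetAt i k s → suc (toℕ f) ≤ s
      earliest k s k<i meet-ik with meetAt-code meet-ik
      ... | f' , refl = s≤s (least f' (k , k<i , meet-ik))
  ... | inj₂ none = (i , fromℕ< (>-nonZero⁻¹ t)) , inj₂ (refl , noMeet)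
    where
      noMeet : ∀ k s → k Fin.< i → ¬ MeetAt i k s
      noMeet k s k<i meet-ik with meetAt-code meet-ik
      ... | f , refl = none f (k , k<i , meet-ik)

  code : Code n t
  code = record
    { hits        = λ i f → isYes (meetAt? i i (suc (toℕ f)))
    ; merge       = λ i → proj₁ (proj₁ (mergeRecord i))
    ; mergeHeight = λ i → proj₂ (proj₁ (mergeRecord i))
    }

module Transfer {n t : ℕ} .{{_ : NonZero t}} (D₁ D₂ : PartialDecomposition n)
                (bounded₁ : HeightAtMost D₁ t) (bounded₂ : HeightAtMost D₂ t)
                (same : Coding.code D₁ t bounded₁ ≋ Coding.code D₂ t bounded₂) where

  private
    module P₁ = Paths D₁
    module P₂ = Paths D₂
    module C₁ = Coding D₁ t bounded₁
    module C₂ = Coding D₂ t bounded₂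

  hits-transfer : ∀ {i s} → P₁.MeetAt i i s → P₂.MeetAt i i s
  hits-transfer {i} meet with C₁.meetAt-code meet
  ... | f , refl = toWitness (subst T (same-hits same i f) (fromWitness meet))

  -- For k < i, the paths of i and k meet exactly where the path of merge i meets that of k
  -- (above the merge height); both of these leaves are smaller than i, which bounds the recursion.
  mutual
    meetAt-transfer : ∀ N i k s → toℕ i < N → toℕ k < N → P₁.MeetAt i k s → P₂.MeetAt i k s
    meetAt-transfer N i k s i<N k<N meet with <-cmp (toℕ k) (toℕ i)
    ... | tri< k<i _ _ = meetAt-transfer-below N i k s i<N k<i meet
    ... | tri≈ _ k≡i _ rewrite toℕ-injective k≡i = hits-transfer meet
    ... | tri> _ _ i<k = P₂.meetAt-sym (meetAt-transfer-below N k i s k<N i<k (P₁.meetAt-sym meet))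

    meetAt-transfer-below : ∀ N i k s → toℕ i < N → k Fin.< i → P₁.MeetAt i k s → P₂.MeetAt i k s
    meetAt-transfer-below (suc N) i k s i<N k<i meet
      with P₁.mergeRecord-below (proj₂ (C₁.mergeRecord i)) k<i meet
    ... | j<i , m≤s , meet-jk =
      P₂.mergeRecord-above (proj₂ (C₂.mergeRecord i))
        (subst (Fin._< i) (same-merge same i) j<i)
        (subst (λ f → suc (toℕ f) ≤ s) (same-mergeHeight same i) m≤s)
        (subst (λ j → P₂.MeetAt j k s) (same-merge same i)
          (meetAt-transfer N _ k s (<-≤-trans j<i (≤-pred i<N)) (<-≤-trans k<i (≤-pred i<N)) meet-jk))

  meetAt⇒ : MeetAt⇒ D₁ D₂
  meetAt⇒ {i} {k} {s} = meetAt-transfer n i k s (toℕ<n i) (toℕ<n k)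

-- ψ sends v to the node of the same height on the path of a leaf below v.
module Correspondence {n : ℕ} (D D' : PartialDecomposition n) (covered : Covered D) (to : MeetAt⇒ D D') where

  private
    module P = Paths D
    module P' = Paths D'

  image : ∀ v → P'.MeetAt (proj₁ (covered v)) (proj₁ (covered v)) (hgt D v)
  image v = to (v , proj₂ (covered v) , proj₂ (covered v) , refl)

  ψ : Fin (size (forest D)) → Fin (size (forest D'))
  ψ v = proj₁ (image v)

  ψ-hgt : ∀ v → hgt D' (ψ v) ≡ hgt D v
  ψ-hgt v = proj₂ (proj₂ (proj₂ (image v)))

  ψ-∈Path : ∀ {i v} → v P.∈Path i → ψ v P'.∈Path i
  ψ-∈Path {i} {v} vi with to (v , proj₂ (covered v) , vi , refl)
  ... | u , ui₀ , ui , hu = subst (P'._∈Path i) u≡ψv ui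
    where u≡ψv = P'.∈Path-hgt-injective ui₀ (proj₁ (proj₂ (image v))) (trans hu (sym (ψ-hgt v)))

ψ-roundtrip : ∀ {n} (D D' : PartialDecomposition n) (covered : Covered D) (covered' : Covered D')
              (to : MeetAt⇒ D D') (from : MeetAt⇒ D' D) →
              ∀ v → Correspondence.ψ D' D covered' from (Correspondence.ψ D D' covered to v) ≡ v
ψ-roundtrip D D' covered covered' to from v =
  Paths.∈Path-hgt-injective D (G.ψ-∈Path (F.ψ-∈Path vi)) vi (trans (G.ψ-hgt (F.ψ v)) (F.ψ-hgt v))
  where
    module F = Correspondence D D' covered to
    module G = Correspondence D' D covered' from
    vi = proj₂ (covered v)

module Equivalence {n : ℕ} (D₁ D₂ : PartialDecomposition n) (covered₁ : Covered D₁) (covered₂ : Covered D₂)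
                   (to : MeetAt⇒ D₁ D₂) (from : MeetAt⇒ D₂ D₁) where

  private
    module P₁ = Paths D₁
    module P₂ = Paths D₂
    module F = Correspondence D₁ D₂ covered₁ to
    module G = Correspondence D₂ D₁ covered₂ from
    h₂ : Fin (size (forest D₂)) → ℕ
    h₂ = hgt D₂

  ψ-emb : ∀ i → F.ψ (emb D₁ i) ≡ emb D₂ i
  ψ-emb i = P₂.∈Path-hgt-injective ψe₁∈ (0 , refl) (≤-antisym ψe₁≤e₂ (P₂.emb-lowest ψe₁∈))
    where
      ψe₁∈ = F.ψ-∈Path (0 , refl)
      ψe₁≤e₂ : h₂ (F.ψ (emb D₁ i)) ≤ h₂ (emb D₂ i)
      ψe₁≤e₂ = subst₂ _≤_ (sym (F.ψ-hgt (emb D₁ i))) (G.ψ-hgt (emb D₂ i))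
                          (P₁.emb-lowest (G.ψ-∈Path (0 , refl)))

  -- On the path of a leaf below v, the parent of v is the node of least height above v, in both decompositions.
  ψ-parent : ∀ v → parent (forest D₂) (F.ψ v) ≡ M.map F.ψ (parent (forest D₁) v)
  ψ-parent v with parent (forest D₁) v in e₁ | parent (forest D₂) (F.ψ v) in e₂
  ... | nothing | nothing = refl
  ... | just u  | nothing =
    let vi = proj₂ (covered₁ v)
        ui , v<u , _ = P₁.parent-∈Path vi e₁
        ψu≤ψv = P₂.root-∈Path (F.ψ-∈Path vi) e₂ (F.ψ-∈Path ui)
    in ⊥-elim (<⇒≱ v<u (subst₂ _≤_ (F.ψ-hgt u) (F.ψ-hgt v) ψu≤ψv))
  ... | nothing | just u' =
    let vi = proj₂ (covered₁ v)
        u'i , ψv<u' , _ = P₂.parent-∈Path (F.ψ-∈Path vi) e₂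
        ψu'≤v = P₁.root-∈Path vi e₁ (G.ψ-∈Path u'i)
    in ⊥-elim (<⇒≱ ψv<u' (subst₂ _≤_ (G.ψ-hgt u') (sym (F.ψ-hgt v)) ψu'≤v))
  ... | just u  | just u' =
    let vi = proj₂ (covered₁ v)
        ui , v<u , least₁ = P₁.parent-∈Path vi e₁
        u'i , ψv<u' , least₂ = P₂.parent-∈Path (F.ψ-∈Path vi) e₂
        ψui = F.ψ-∈Path ui
        u'≤ψu = least₂ ψui (subst₂ _<_ (sym (F.ψ-hgt v)) (sym (F.ψ-hgt u)) v<u)
        ψu≤u' = subst₂ _≤_ (sym (F.ψ-hgt u)) (G.ψ-hgt u')
                  (least₁ (G.ψ-∈Path u'i) (subst₂ _<_ (F.ψ-hgt v) (sym (G.ψ-hgt u')) ψv<u'))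
    in cong just (P₂.∈Path-hgt-injective u'i ψui (≤-antisym u'≤ψu ψu≤u'))

  equivalent : Equivalent D₁ D₂
  equivalent = mk↔ₛ′ F.ψ G.ψ (ψ-roundtrip D₂ D₁ covered₂ covered₁ from to)
                             (ψ-roundtrip D₁ D₂ covered₁ covered₂ to from)
             , ψ-parent , ψ-emb , sym ∘ F.ψ-hgt

restriction-covered : ∀ {n} (D : PartialDecomposition n) → IsRestrictionOfTree D → Covered D
restriction-covered D (T , _ , ι , _ , φ , φ-injective , φ-parent , φ-emb , below-X , _ , _) v
  with below-X (φ v) (v , refl)
... | i , k , e = i , k , map-injective φ-injective (begin
  M.map φ (iterParent (parent (forest D)) k (emb D i))  ≡⟨ iterParent-map φ φ-parent k (emb D i) ⟨
  iterParent (parent T) k (φ (emb D i))                 ≡⟨ cong (iterParent (parent T) k) (φ-emb i) ⟩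
  iterParent (parent T) k (ι i)                         ≡⟨ e ⟩
  just (φ v)                                            ∎)
  where open ≡-Reasoning

mainTheorem17 : (n t : ℕ) → 1 ≤ t →
    Σ ((D : PartialDecomposition n) → IsRestrictionOfTree D → HeightAtMost D t → Fin (bound n t))
    λ c → ∀ D₁ D₂ r₁ r₂ h₁ h₂ → c D₁ r₁ h₁ ≡ c D₂ r₂ h₂ → Equivalent D₁ D₂
mainTheorem17 n (suc t) _ = code , code-injective
  where
    code : (D : PartialDecomposition n) → IsRestrictionOfTree D → HeightAtMost D (suc t) → Fin (bound n (suc t))
    code D _ bounded = encode (Coding.code D (suc t) bounded)

    code-injective : ∀ D₁ D₂ r₁ r₂ b₁ b₂ → code D₁ r₁ b₁ ≡ code D₂ r₂ b₂ → Equivalent D₁ D₂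
    code-injective D₁ D₂ r₁ r₂ b₁ b₂ eq =
      Equivalence.equivalent D₁ D₂ (restriction-covered D₁ r₁) (restriction-covered D₂ r₂)
        (Transfer.meetAt⇒ D₁ D₂ b₁ b₂ same) (Transfer.meetAt⇒ D₂ D₁ b₂ b₁ (≋-sym same))
      where same = encode-injective (Coding.code D₁ (suc t) b₁) (Coding.code D₂ (suc t) b₂) eq
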